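{- For a finite connected graph $G$, the following are equivalent: (1) $G$ is $1$-loopy; (2) $G_{\mathrm{irr}}$ is strongly connected; (3) $G$ is not a cycle and every vertex of $G$ has degree at least $2$. In particular, if $G$ is connected and $d$-regular with $d\ge3$, then $G_{\mathrm{irr}}$ is strongly connected.
   Context: A graph consists of a vertex set, a set of directed edges each with an origin and a terminus, and an involution $\mathrm{opp}$ on directed edges such that $\mathrm{opp}(e)$ goes from the terminus of $e$ to its origin. Undirected edges are the orbits $\{e,\mathrm{opp}(e)\}$. A self-loop $e$ with $\mathrm{opp}(e)=e$ is a half-loop; two distinct self-loops at a vertex paired by $\mathrm{opp}$ form a whole-loop. The degree of a vertex is the number of directed edges originating there (a whole-loop contributes $2$, a half-loop $1$); $d$-regular means every vertex has degree $d$. $G_{\mathrm{irr}}$ is the directed graph whose vertices are the directed edges of $G$, with an edge from $e_1$ to $e_2$ iff $e_1$ terminates at the origin of $e_2$ and $e_2\neq\mathrm{opp}(e_1)$. A connected graph is loopy if it has at least as many (undirected) edges as vertices (equivalently, it is not a tree), and $1$-loopy if it is connected and removing any one undirected edge leaves a graph each of whose connected components is loopy. A cycle is a connected graph whose vertices and edges can be listed as $v_0,e_1,v_1,\dots,e_m,v_m=v_0$ with $v_0,\dots,v_{m-1}$ distinct, $e_1,\dots,e_m$ distinct undirected edges, $e_i$ joining $v_{i-1}$ and $v_i$, and no other edges. -}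

module Defs where

open import Data.Nat using (ℕ; zero; suc; _≤_; _<_)
open import Data.Fin using (Fin; toℕ; _≟_)
open import Data.Fin.Subset using (Subset; ∣_∣)
open import Data.Bool using (Bool; true; false; T; not; _∧_)
open import Data.List using (List; length; filterᵇ; allFin)
open import Data.Vec using (lookup)
open import Data.Product using (Σ; ∃; _×_; _,_)
open import Data.Sum using (_⊎_)
open import Relation.Nullary using (¬_; does)
open import Relation.Binary.PropositionalEquality using (_≡_; _≢_)

record Graph : Set where
  field
    n   : ℕ
    m   : ℕ
    org : Fin m → Fin n
    ter : Fin m → Fin n
    opp : Fin m → Fin m
    opp-invol : ∀ e → opp (opp e) ≡ e
    opp-org   : ∀ e → org (opp e) ≡ ter e
    opp-ter   : ∀ e → ter (opp e) ≡ org e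

module _ (G : Graph) where
  open Graph G

  _==_ : Fin m → Fin m → Bool
  d == e = does (d ≟ e)

  data Walk (ok : Fin m → Bool) : Fin n → Fin n → Set where
    here : ∀ {x} → Walk ok x x
    step : ∀ {y} (d : Fin m) → T (ok d) → Walk ok (ter d) y → Walk ok (org d) y

  Connected : Set
  Connected = (0 < n) × (∀ x y → Walk (λ _ → true) x y)

  degree : Fin n → ℕ
  degree v = length (filterᵇ (λ d → does (org d ≟ v)) (allFin m))

  Regular : ℕ → Set
  Regular k = ∀ v → degree v ≡ k

  keptWithout : Fin m → Fin m → Bool
  keptWithout e d = not (d == e) ∧ not (d == opp e)

  -- S is a connected component of the subgraph with edge set ok
  -- (ok assumed closed under opp): nonempty, closed under ok-edges,
  -- and any two of its vertices joined by an ok-walk.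
  IsComponent : (Fin m → Bool) → Subset n → Set
  IsComponent ok S =
    (∃ λ x → lookup S x ≡ true) ×
    (∀ d → T (ok d) → lookup S (org d) ≡ true → lookup S (ter d) ≡ true) ×
    (∀ x y → lookup S x ≡ true → lookup S y ≡ true → Walk ok x y)

  -- Number of undirected ok-edges of the component S: count one directed
  -- representative (the one with toℕ d ≤ toℕ (opp d)) of each orbit {d, opp d}.
  undirectedEdgesIn : (Fin m → Bool) → Subset n → ℕ
  undirectedEdgesIn ok S =
    length (filterᵇ (λ d → ok d ∧ lookup S (org d) ∧ does (toℕ d Data.Nat.≤? toℕ (opp d)))
                    (allFin m))

  LoopyComponent : (Fin m → Bool) → Subset n → Set
  LoopyComponent ok S = ∣ S ∣ ≤ undirectedEdgesIn ok S

  OneLoopy : Set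
  OneLoopy = Connected ×
    (∀ e (S : Subset n) → IsComponent (keptWithout e) S → LoopyComponent (keptWithout e) S)

  -- G_irr: vertices are directed edges; e₁ → e₂ iff ter e₁ = org e₂ and e₂ ≠ opp e₁.
  IrrEdge : Fin m → Fin m → Set
  IrrEdge e₁ e₂ = (ter e₁ ≡ org e₂) × (e₂ ≢ opp e₁)

  data IrrPath : Fin m → Fin m → Set where
    one  : ∀ {a b} → IrrEdge a b → IrrPath a b
    cons : ∀ {a b c} → IrrEdge a b → IrrPath b c → IrrPath a c

  IrrStronglyConnected : Set
  IrrStronglyConnected = ∀ a b → IrrPath a b

  -- Here v : ℕ → Fin n and the i-th edge (0-based) is represented
  -- by the directed edge ed i from v i to v (suc i).
  IsCycle : Set
  IsCycle = Connected × Σ ℕ λ k → Σ (ℕ → Fin n) λ v → Σ (ℕ → Fin m) λ ed →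
    (0 < k) ×
    (v k ≡ v 0) ×
    (∀ i j → i < k → j < k → v i ≡ v j → i ≡ j) ×
    (∀ x → ∃ λ i → (i < k) × (v i ≡ x)) ×
    (∀ i → i < k → (org (ed i) ≡ v i) × (ter (ed i) ≡ v (suc i))) ×
    (∀ i j → i < k → j < k → i ≢ j → (ed i ≢ ed j) × (ed i ≢ opp (ed j))) ×
    (∀ d → ∃ λ i → (i < k) × ((d ≡ ed i) ⊎ (d ≡ opp (ed i))))

module Submission where

-- A non-backtracking walk can turn around only by running around a cycle, so
-- G_irr is strongly connected as soon as every dart a reaches its opposite
-- opp a.  Suppose all degrees are at least 2 and some dart a cannot reach opp a.
-- Then the darts reachable from a never contain a dart together with its
-- opposite, so at most one of them enters each vertex; a chosen non-backtracking
-- successor is therefore injective on them, hence a permutation of this finite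
-- set, and the successor orbit of a traverses G as a cycle.  A cycle in turn
-- keeps every non-backtracking walk going in one direction.
--
-- Deleting an edge of a cycle leaves a spanning tree, and deleting the only edge
-- at a vertex of degree 1 isolates it, so 1-loopy graphs are not cycles and have
-- minimum degree 2.  Conversely, let G_irr be strongly connected and let S be a
-- component of G - e with fewer edges than vertices.  Count the darts leaving
-- vertices of S: the degrees give at least 2|S| of them, while each edge of
-- G - e inside S contributes at most two (one if it is a half-loop) and e at
-- most two more.  Hence every vertex of S has degree 2, both ends of e lie in S,
-- so S is all of G, and there are no half-loops.  In such a graph the successor
-- is unique and commutes with reversal, and a walk from a to opp a would fold at
-- its midpoint into a half-loop or a backtrack.

open import Defs

open import Data.Bool using (Bool; true; false; T; T?; not; _∧_; _∨_; if_then_else_)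
open import Data.Bool.Properties using (∧-identityʳ; ∧-zeroʳ; ∨-identityʳ; T-∧; T-∨; T-≡)
open import Data.Empty using (⊥; ⊥-elim)
open import Data.Fin using (Fin; zero; suc; _≟_; fromℕ<; toℕ)
open import Data.Fin.Properties using (any?; pigeonhole; injective⇒≤)
import Data.Fin.Properties as Fin
open import Data.Fin.Subset using (Subset; ∣_∣; ⊤; ⁅_⁆)
open import Data.Fin.Subset.Properties using (∣⊤∣≡n; ∣⁅x⁆∣≡1; x∈⁅x⁆; x∈⁅y⁆⇒x≡y)
open import Data.List using (length; filterᵇ; allFin)
import Data.List as List
open import Data.Nat using (ℕ; zero; suc; _+_; _∸_; _≤_; _<_; z≤n; s≤s)
open import Data.Nat.GeneralisedArithmetic using (fold; fold-+)
open import Data.Nat.Properties hiding (_≟_)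
open import Algebra.Properties.CommutativeMonoid.Sum +-0-commutativeMonoid
  using (sum; sum-cong-≗; ∑-distrib-+; ∑-comm)
open import Data.Product using (∃; _×_; _,_; proj₁; proj₂)
open import Data.Sum using (_⊎_; inj₁; inj₂)
open import Data.Unit using (tt)
open import Data.Vec using (Vec; []; _∷_; lookup)
open import Data.Vec.Membership.Propositional using (_∈_)
open import Data.Vec.Properties using (lookup-replicate; []=⇒lookup; lookup⇒[]=)
open import Data.Vec.Relation.Unary.All using (All; []; _∷_)
import Data.Vec.Relation.Unary.All as All
open import Data.Vec.Relation.Unary.All.Properties using (lookup⁺)
open import Data.Vec.Relation.Unary.AllPairs using ([]; _∷_)
open import Data.Vec.Relation.Unary.Any using (here; there)
open import Data.Vec.Relation.Unary.Unique.Propositional using (Unique)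
open import Data.Vec.Relation.Unary.Unique.Propositional.Properties using (lookup-injective)
open import Function using (_∘_; id; case_of_)
open import Function.Bundles using (Equivalence; _⇔_; mk⇔)
open Equivalence using (to; from)
open import Relation.Binary.Construct.Closure.Transitive using (TransClosure; [_]; _∷_; _∷ʳ_; _++_)
open import Relation.Binary.Definitions using (Decidable; tri<; tri≈; tri>)
open import Relation.Binary.PropositionalEquality
open import Relation.Nullary using (¬_; Dec; does; yes; no; ¬?; _×-dec_)

does-sound : ∀ {A : Set} (a? : Dec A) → T (does a?) → A
does-sound (yes a) _ = a

does-complete : ∀ {A : Set} (a? : Dec A) → A → T (does a?)
does-complete (yes _) _  = tt
does-complete (no ¬a) a = ¬a a

¬T⇒T-not : ∀ {b} → ¬ T b → T (not b)
¬T⇒T-not {false} _  = tt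
¬T⇒T-not {true}  ¬b = ¬b tt

T-not⇒¬T : ∀ {b} → T (not b) → ¬ T b
T-not⇒¬T {false} _ ()

indicator : Bool → ℕ
indicator b = if b then 1 else 0

count : ∀ {k} → (Fin k → Bool) → ℕ
count P = sum (indicator ∘ P)

count-cong : ∀ {k} {P Q : Fin k → Bool} → (∀ i → P i ≡ Q i) → count P ≡ count Q
count-cong P≗Q = sum-cong-≗ (λ i → cong indicator (P≗Q i))

count-none : ∀ {k} (P : Fin k → Bool) → (∀ i → ¬ T (P i)) → count P ≡ 0
count-none {zero}  P ¬P = refl
count-none {suc k} P ¬P with P zero in eq
... | true  = ⊥-elim (¬P zero (from T-≡ eq))
... | false = count-none (P ∘ suc) (¬P ∘ suc)

count-all : ∀ k → count {k} (λ _ → true) ≡ k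
count-all zero    = refl
count-all (suc k) = cong suc (count-all k)

count≤size : ∀ {k} (P : Fin k → Bool) → count P ≤ k
count≤size {zero}  P = z≤n
count≤size {suc k} P with P zero
... | true  = s≤s (count≤size (P ∘ suc))
... | false = m≤n⇒m≤1+n (count≤size (P ∘ suc))

count-split : ∀ {k} (P Q : Fin k → Bool) →
  count P ≡ count (λ i → P i ∧ Q i) + count (λ i → P i ∧ not (Q i))
count-split {zero}  P Q = refl
count-split {suc k} P Q with P zero | Q zero | count-split (P ∘ suc) (Q ∘ suc)
... | true  | true  | IH = cong suc IH
... | true  | false | IH = trans (cong suc IH) (sym (+-suc _ _))
... | false | _     | IH = IH

count-positive : ∀ {k} (P : Fin k → Bool) {i} → T (P i) → 0 < count P
count-positive P {zero} Pi with P zero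
... | true = s≤s z≤n
count-positive P {suc i} Pi with P zero
... | true  = s≤s z≤n
... | false = count-positive (P ∘ suc) Pi

count-remove : ∀ {k} (P : Fin k → Bool) {t} → T (P t) →
  count P ≡ suc (count (λ i → P i ∧ not (does (i ≟ t))))
count-remove P {zero} Pt with P zero
... | true = cong suc (count-cong (λ i → sym (∧-identityʳ (P (suc i)))))
count-remove P {suc t} Pt with P zero | count-remove (P ∘ suc) Pt
... | true  | IH = cong suc IH
... | false | IH = IH

count-injection : ∀ {a b} (P : Fin a → Bool) (Q : Fin b → Bool) (φ : Fin a → Fin b) →
  (∀ i → T (P i) → T (Q (φ i))) →
  (∀ i j → T (P i) → T (P j) → φ i ≡ φ j → i ≡ j) →
  count P ≤ count Q
count-injection {zero}  P Q φ PQ inj = z≤n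
count-injection {suc a} P Q φ PQ inj with P zero in eq
... | false = count-injection (P ∘ suc) Q (φ ∘ suc) (PQ ∘ suc) inj-suc
  where
  inj-suc : ∀ i j → T (P (suc i)) → T (P (suc j)) → φ (suc i) ≡ φ (suc j) → i ≡ j
  inj-suc i j Pi Pj = Fin.suc-injective ∘ inj (suc i) (suc j) Pi Pj
... | true  = begin
    suc (count (P ∘ suc)) ≤⟨ s≤s (count-injection (P ∘ suc) Q′ (φ ∘ suc) PQ′ inj-suc) ⟩
    suc (count Q′)        ≡⟨ count-remove Q (PQ zero P₀) ⟨
    count Q ∎
  where
  open ≤-Reasoning
  P₀ : T (P zero)
  P₀ = from T-≡ eq
  Q′ : Fin _ → Bool
  Q′ j = Q j ∧ not (does (j ≟ φ zero))
  PQ′ : ∀ i → T (P (suc i)) → T (Q′ (φ (suc i)))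
  PQ′ i Pi with φ (suc i) ≟ φ zero
  ... | yes φi≡φ₀ with () ← inj (suc i) zero Pi P₀ φi≡φ₀
  ... | no _ = subst T (sym (∧-identityʳ _)) (PQ (suc i) Pi)
  inj-suc : ∀ i j → T (P (suc i)) → T (P (suc j)) → φ (suc i) ≡ φ (suc j) → i ≡ j
  inj-suc i j Pi Pj = Fin.suc-injective ∘ inj (suc i) (suc j) Pi Pj

count≤cover : ∀ {k j} (P : Fin k → Bool) (xs : Vec (Fin k) j) →
  (∀ i → T (P i) → i ∈ xs) → count P ≤ j
count≤cover P [] cover = ≤-reflexive (count-none P (λ i Pi → case cover i Pi of λ ()))
count≤cover P (x ∷ xs) cover with P x in eq
... | false = m≤n⇒m≤1+n (count≤cover P xs cover′)
  where
  cover′ : ∀ i → T (P i) → i ∈ xs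
  cover′ i Pi with cover i Pi
  ... | here refl = ⊥-elim (subst T eq Pi)
  ... | there i∈xs = i∈xs
... | true = begin
    count P                                    ≡⟨ count-remove P (from T-≡ eq) ⟩
    suc (count (λ i → P i ∧ not (does (i ≟ x)))) ≤⟨ s≤s (count≤cover _ xs cover′) ⟩
    suc _ ∎
  where
  open ≤-Reasoning
  cover′ : ∀ i → T (P i ∧ not (does (i ≟ x))) → i ∈ xs
  cover′ i Pi with i ≟ x | cover i
  ... | yes _ | _ = ⊥-elim (subst T (∧-zeroʳ (P i)) Pi)
  ... | no i≢x | c with c (subst T (∧-identityʳ _) Pi)
  ...   | here i≡x = ⊥-elim (i≢x i≡x)
  ...   | there i∈xs = i∈xs

distinct≤count : ∀ {k j} (P : Fin k → Bool) (xs : Vec (Fin k) j) →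
  Unique xs → All (T ∘ P) xs → j ≤ count P
distinct≤count {j = j} P xs xs! Pxs = begin
  j                      ≡⟨ count-all j ⟨
  count {j} (λ _ → true) ≤⟨ count-injection _ P (lookup xs) (λ t _ → lookup⁺ Pxs t)
                              (λ s t _ _ → lookup-injective xs! s t) ⟩
  count P ∎
  where open ≤-Reasoning

count-⊆-reverse : ∀ {k} (P Q : Fin k → Bool) → (∀ i → T (P i) → T (Q i)) →
  count Q ≤ count P → ∀ i → T (Q i) → T (P i)
count-⊆-reverse P Q P⊆Q Q≤P i Qi with P i in eq
... | true = tt
... | false = ⊥-elim (<⇒≱ (begin-strict
    count P                                    ≡⟨ count-cong Q∧P≡P ⟨
    count (λ j → Q j ∧ P j)                    <⟨ m<m+n _ (count-positive _ {i} Qi∧¬Pi) ⟩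
    count (λ j → Q j ∧ P j) + count (λ j → Q j ∧ not (P j)) ≡⟨ count-split Q P ⟨
    count Q ∎) Q≤P)
  where
  open ≤-Reasoning
  Qi∧¬Pi : T (Q i ∧ not (P i))
  Qi∧¬Pi rewrite eq = subst T (sym (∧-identityʳ (Q i))) Qi
  Q∧P≡P : ∀ j → Q j ∧ P j ≡ P j
  Q∧P≡P j with P j in eqj
  ... | false = ∧-zeroʳ (Q j)
  ... | true with Q j | P⊆Q j (from T-≡ eqj)
  ...   | true | _ = refl

count-point : ∀ {k} (t : Fin k) → count (λ i → does (t ≟ i)) ≡ 1
count-point {suc k} zero = cong suc (count-none {k} (λ _ → false) (λ _ ()))
count-point (suc t)      = count-point t

count-fibres : ∀ {a b} (f : Fin a → Fin b) (P : Fin a → Bool) →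
  sum (λ y → count (λ x → P x ∧ does (f x ≟ y))) ≡ count P
count-fibres {b = b} f P = begin
  sum (λ y → count (λ x → P x ∧ does (f x ≟ y))) ≡⟨ ∑-comm (λ y x → indicator (P x ∧ does (f x ≟ y))) ⟩
  sum (λ x → count (λ y → P x ∧ does (f x ≟ y))) ≡⟨ sum-cong-≗ fibre ⟩
  count P ∎
  where
  open ≡-Reasoning
  fibre : ∀ x → count (λ y → P x ∧ does (f x ≟ y)) ≡ indicator (P x)
  fibre x with P x
  ... | true  = count-point (f x)
  ... | false = count-none {b} (λ _ → false) (λ _ ())

length-filterᵇ-allFin : ∀ {k} (P : Fin k → Bool) → length (filterᵇ P (allFin k)) ≡ count P
length-filterᵇ-allFin P = length-filterᵇ-tabulate P (λ i → i)
  where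
  length-filterᵇ-tabulate : ∀ {A : Set} {k} (P : A → Bool) (f : Fin k → A) →
    length (filterᵇ P (List.tabulate f)) ≡ count (P ∘ f)
  length-filterᵇ-tabulate {k = zero}  P f = refl
  length-filterᵇ-tabulate {k = suc k} P f with P (f zero)
  ... | true  = cong suc (length-filterᵇ-tabulate P (f ∘ suc))
  ... | false = length-filterᵇ-tabulate P (f ∘ suc)

∣p∣≡count : ∀ {k} (p : Subset k) → ∣ p ∣ ≡ count (lookup p)
∣p∣≡count []          = refl
∣p∣≡count (true ∷ p)  = cong suc (∣p∣≡count p)
∣p∣≡count (false ∷ p) = ∣p∣≡count p

sum-mono : ∀ {k} {f g : Fin k → ℕ} → (∀ i → f i ≤ g i) → sum f ≤ sum g
sum-mono {zero}  f≤g = z≤n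
sum-mono {suc k} f≤g = +-mono-≤ (f≤g zero) (sum-mono (f≤g ∘ suc))

sum-tight : ∀ {k} (f g : Fin k → ℕ) → (∀ i → g i ≤ f i) → sum f ≤ sum g → ∀ i → f i ≡ g i
sum-tight f g g≤f Σf≤Σg zero = ≤-antisym f₀≤g₀ (g≤f zero)
  where
  f₀≤g₀ : f zero ≤ g zero
  f₀≤g₀ = +-cancelʳ-≤ (sum (f ∘ suc)) (f zero) (g zero)
            (≤-trans Σf≤Σg (+-monoʳ-≤ (g zero) (sum-mono (g≤f ∘ suc))))
sum-tight f g g≤f Σf≤Σg (suc i) = sum-tight (f ∘ suc) (g ∘ suc) (g≤f ∘ suc)
  (+-cancelˡ-≤ (f zero) _ _ (≤-trans Σf≤Σg (+-monoˡ-≤ (sum (g ∘ suc)) (g≤f zero)))) i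

even-or-odd : ∀ n → ∃ λ i → n ≡ i + i ⊎ n ≡ suc (i + i)
even-or-odd zero    = 0 , inj₁ refl
even-or-odd (suc n) with even-or-odd n
... | i , inj₁ n≡i+i   = i , inj₂ (cong suc n≡i+i)
... | i , inj₂ n≡1+i+i = suc i , inj₁ (cong suc (trans n≡1+i+i (sym (+-suc i i))))

squeeze : ∀ {s u N X H} → s + s ≤ N + X → N + H ≤ u + u → X ≤ 2 → u < s →
  X ≡ 2 × H ≡ 0 × N + X ≤ s + s
squeeze {s} {u} {N} {X} {H} 2s≤N+X N+H≤2u X≤2 u<s =
  ≤-antisym X≤2 2≤X , n≤0⇒n≡0 (+-cancelˡ-≤ N H 0 N+H≤N) , ≤-trans N+X≤2u+2 2u+2≤2s
  where
  open ≤-Reasoning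
  N≤2u : N ≤ u + u
  N≤2u = ≤-trans (m≤m+n N H) N+H≤2u
  2u+2≤2s : u + u + 2 ≤ s + s
  2u+2≤2s = begin
    u + u + 2           ≡⟨ +-comm (u + u) 2 ⟩
    suc (suc (u + u))   ≡⟨ cong suc (+-suc u u) ⟨
    suc u + suc u       ≤⟨ +-mono-≤ u<s u<s ⟩
    s + s ∎
  N+X≤2u+2 : N + X ≤ u + u + 2
  N+X≤2u+2 = +-mono-≤ N≤2u X≤2
  2u+2≤N+X : u + u + 2 ≤ N + X
  2u+2≤N+X = ≤-trans 2u+2≤2s 2s≤N+X
  2≤X : 2 ≤ X
  2≤X = +-cancelˡ-≤ (u + u) 2 X (≤-trans 2u+2≤N+X (+-monoˡ-≤ X N≤2u))
  N+H≤N : N + H ≤ N + 0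
  N+H≤N = begin
    N + H     ≤⟨ N+H≤2u ⟩
    u + u     ≤⟨ +-cancelʳ-≤ 2 (u + u) N (≤-trans 2u+2≤N+X (+-monoʳ-≤ N X≤2)) ⟩
    N         ≡⟨ +-identityʳ N ⟨
    N + 0 ∎

least-witness : ∀ {P : ℕ → Set} → (∀ i → Dec (P i)) → ∀ {n} → P n →
  ∃ λ k → P k × (∀ j → j < k → ¬ P j)
least-witness {P} P? {n} Pn = search 0 n (λ _ ()) (subst P (sym (+-identityˡ n)) Pn)
  where
  search : ∀ i slack → (∀ j → j < i → ¬ P j) → P (i + slack) → ∃ λ k → P k × (∀ j → j < k → ¬ P j)
  search i slack below with P? i
  search i slack       below | yes Pi = λ _ → i , Pi , below
  search i zero        below | no ¬Pi = λ Pi → ⊥-elim (¬Pi (subst P (+-identityʳ i) Pi))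
  search i (suc slack) below | no ¬Pi = search (suc i) slack below′ ∘ subst P (+-suc i slack)
    where
    below′ : ∀ j → j < suc i → ¬ P j
    below′ j j<1+i with m≤n⇒m<n∨m≡n (≤-pred j<1+i)
    ... | inj₁ j<i  = below j j<i
    ... | inj₂ refl = ¬Pi

module _ {k} {_∼_ : Fin k → Fin k → Set} (_∼?_ : Decidable _∼_) where

  private
    _∼⁺_ : Fin k → Fin k → Set
    _∼⁺_ = TransClosure _∼_

  Closed : (Fin k → Bool) → Set
  Closed S = ∀ {x y} → T (S x) → x ∼ y → T (S y)

  record Approximation (a : Fin k) (S : Fin k → Bool) : Set where
    field
      sound     : ∀ {x} → T (S x) → a ∼⁺ x
      complete₁ : ∀ {x} → a ∼ x → T (S x)

  private
    insert : (Fin k → Bool) → Fin k → Fin k → Bool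
    insert S y z = S z ∨ does (z ≟ y)

    count-insert : ∀ S {y} → ¬ T (S y) → count (not ∘ S) ≡ suc (count (not ∘ insert S y))
    count-insert S {y} ¬Sy = trans (count-remove (not ∘ S) (¬T⇒T-not ¬Sy)) (cong suc (count-cong deMorgan))
      where
      deMorgan : ∀ z → not (S z) ∧ not (does (z ≟ y)) ≡ not (insert S y z)
      deMorgan z with S z
      ... | true  = refl
      ... | false = refl

  saturate : ∀ {a} fuel S → count (not ∘ S) ≤ fuel → Approximation a S →
             ∃ λ S′ → Approximation a S′ × Closed S′
  saturate fuel S bound approx
    with any? (λ x → any? (λ y → T? (S x) ×-dec ¬? (T? (S y)) ×-dec x ∼? y))
  ... | no noExit = S , approx , closed
    where
    closed : Closed S
    closed {x} {y} Sx x∼y with T? (S y)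
    ... | yes Sy = Sy
    ... | no ¬Sy = ⊥-elim (noExit (x , y , Sx , ¬Sy , x∼y))
  saturate zero S bound approx | yes (x , y , Sx , ¬Sy , x∼y) =
    ⊥-elim (<⇒≱ (subst (0 <_) (sym (count-insert S ¬Sy)) (s≤s z≤n)) bound)
  saturate (suc fuel) S bound approx | yes (x , y , Sx , ¬Sy , x∼y) =
    saturate fuel (insert S y) (≤-pred (subst (_≤ suc fuel) (count-insert S ¬Sy) bound)) approx′
    where
    open Approximation approx
    approx′ : Approximation _ (insert S y)
    approx′ .Approximation.sound {z} Sz with T? (S z) | z ≟ y
    ... | yes Sz′ | _ = sound Sz′
    ... | no _ | yes refl = sound Sx ∷ʳ x∼y
    ... | no ¬Sz | no _ = ⊥-elim (¬Sz (subst T (∨-identityʳ (S z)) Sz))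
    approx′ .Approximation.complete₁ a∼z = from T-∨ (inj₁ (complete₁ a∼z))

  TransClosure? : Decidable _∼⁺_
  TransClosure? a b with saturate k (λ x → does (a ∼? x)) (count≤size _) successors
    where
    successors : Approximation a (λ x → does (a ∼? x))
    successors = record
      { sound     = λ {x} a∼x → [ does-sound (a ∼? x) a∼x ]
      ; complete₁ = λ {x} → does-complete (a ∼? x)
      }
  ... | S , approx , closed with T? (S b)
  ...   | yes Sb = yes (Approximation.sound approx Sb)
  ...   | no ¬Sb = no (¬Sb ∘ reached)
    where
    propagate : ∀ {x y} → T (S x) → x ∼⁺ y → T (S y)
    propagate Sx [ x∼y ]        = closed Sx x∼y
    propagate Sx (x∼z ∷ z∼⁺y) = propagate (closed Sx x∼z) z∼⁺y
    reached : ∀ {y} → a ∼⁺ y → T (S y)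
    reached [ a∼y ]        = Approximation.complete₁ approx a∼y
    reached (a∼z ∷ z∼⁺y) = propagate (Approximation.complete₁ approx a∼z) z∼⁺y

module Darts (G : Graph) where
  open Graph G

  infix 4 _⇝_
  _⇝_ : Fin m → Fin m → Set
  _⇝_ = TransClosure (IrrEdge G)

  IrrPath⇒⇝ : ∀ {a b} → IrrPath G a b → a ⇝ b
  IrrPath⇒⇝ (one a∼b)      = [ a∼b ]
  IrrPath⇒⇝ (cons a∼c c⇝b) = a∼c ∷ IrrPath⇒⇝ c⇝b

  ⇝⇒IrrPath : ∀ {a b} → a ⇝ b → IrrPath G a b
  ⇝⇒IrrPath [ a∼b ]        = one a∼b
  ⇝⇒IrrPath (a∼c ∷ c⇝b) = cons a∼c (⇝⇒IrrPath c⇝b)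

  opp-injective : ∀ {x y} → opp x ≡ opp y → x ≡ y
  opp-injective {x} {y} eq = trans (sym (opp-invol x)) (trans (cong opp eq) (opp-invol y))

  IrrEdge-reverse : ∀ {a b} → IrrEdge G a b → IrrEdge G (opp b) (opp a)
  IrrEdge-reverse {a} {b} (ter≡org , b≢opp) =
    trans (opp-ter b) (trans (sym ter≡org) (sym (opp-org a))) ,
    λ opp-a≡ → b≢opp (sym (trans opp-a≡ (opp-invol b)))

  ⇝-reverse : ∀ {a b} → a ⇝ b → opp b ⇝ opp a
  ⇝-reverse [ a∼b ]        = [ IrrEdge-reverse a∼b ]
  ⇝-reverse (a∼c ∷ c⇝b) = ⇝-reverse c⇝b ∷ʳ IrrEdge-reverse a∼c

  IrrEdge? : Decidable (IrrEdge G)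
  IrrEdge? a b = (ter a ≟ org b) ×-dec ¬? (b ≟ opp a)

  _⇝?_ : Decidable _⇝_
  _⇝?_ = TransClosure? IrrEdge?

  _++ʷ_ : ∀ {ok x y z} → Walk G ok x y → Walk G ok y z → Walk G ok x z
  here          ++ʷ w′ = w′
  step d okd w ++ʷ w′ = step d okd (w ++ʷ w′)

  stepʷ : ∀ {ok x y z} d → T (ok d) → org d ≡ x → ter d ≡ y → Walk G ok y z → Walk G ok x z
  stepʷ d okd refl refl w = step d okd w

  reverseʷ : ∀ {ok x y} → (∀ {d} → T (ok d) → T (ok (opp d))) → Walk G ok x y → Walk G ok y x
  reverseʷ ok-opp here          = here
  reverseʷ ok-opp (step d okd w) =
    reverseʷ ok-opp w ++ʷ stepʷ (opp d) (ok-opp okd) (opp-org d) (opp-ter d) here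

  connected-induction : Connected G → (P : Fin n → Set) → (∀ d → P (org d) → P (ter d)) →
    ∀ {x} → P x → ∀ y → P y
  connected-induction (_ , walk) P step-P {x} Px y = along (walk x y) Px
    where
    along : ∀ {ok x y} → Walk G ok x y → P x → P y
    along here          Px = Px
    along (step d _ w) Px = along w (step-P d Px)

  outFrom : Fin n → Fin m → Bool
  outFrom v d = does (org d ≟ v)

  degree≡count : ∀ v → degree G v ≡ count (outFrom v)
  degree≡count v = length-filterᵇ-allFin (outFrom v)

  distinct-out⇒≤degree : ∀ {v j} (ds : Vec (Fin m) j) → Unique ds → All (λ d → org d ≡ v) ds →
    j ≤ degree G v
  distinct-out⇒≤degree {v} ds ds! from-v = subst (_ ≤_) (sym (degree≡count v))
    (distinct≤count (outFrom v) ds ds! (All.map (λ {d} → does-complete (org d ≟ v)) from-v))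

  degree≤cover : ∀ {v j} (ds : Vec (Fin m) j) → (∀ d → org d ≡ v → d ∈ ds) → degree G v ≤ j
  degree≤cover {v} ds cover = subst (_≤ _) (sym (degree≡count v))
    (count≤cover (outFrom v) ds (λ d from-v → cover d (does-sound (org d ≟ v) from-v)))

  two-out⇒2≤degree : ∀ {v p q} → org p ≡ v → org q ≡ v → p ≢ q → 2 ≤ degree G v
  two-out⇒2≤degree {p = p} {q} op oq p≢q =
    distinct-out⇒≤degree (p ∷ q ∷ []) ((p≢q ∷ []) ∷ [] ∷ []) (op ∷ oq ∷ [])

  another-out : ∀ {v} → 2 ≤ degree G v → ∀ x → ∃ λ d → org d ≡ v × d ≢ x
  another-out {v} 2≤deg x with any? (λ d → (org d ≟ v) ×-dec ¬? (d ≟ x))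
  ... | yes found = found
  ... | no none = ⊥-elim (<⇒≱ 2≤deg (degree≤cover (x ∷ []) only-x))
    where
    only-x : ∀ d → org d ≡ v → d ∈ x ∷ []
    only-x d od with d ≟ x
    ... | yes d≡x = here d≡x
    ... | no d≢x  = ⊥-elim (none (d , od , d≢x))

  out-pair : ∀ {v p q d} → degree G v ≤ 2 → org p ≡ v → org q ≡ v → p ≢ q → org d ≡ v →
    d ≡ p ⊎ d ≡ q
  out-pair {p = p} {q} {d} deg≤2 op oq p≢q od with d ≟ p | d ≟ q
  ... | yes d≡p | _       = inj₁ d≡p
  ... | no _    | yes d≡q = inj₂ d≡q
  ... | no d≢p  | no d≢q  = ⊥-elim (<⇒≱ (s≤s deg≤2)
    (distinct-out⇒≤degree (_ ∷ _ ∷ _ ∷ [])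
      ((p≢q ∷ (d≢p ∘ sym) ∷ []) ∷ ((d≢q ∘ sym) ∷ []) ∷ [] ∷ []) (op ∷ oq ∷ od ∷ [])))

  out-dart : Connected G → 0 < m → ∀ v → ∃ λ d → org d ≡ v
  out-dart (_ , walk) 0<m v with walk v (org (fromℕ< 0<m))
  ... | here         = fromℕ< 0<m , refl
  ... | step d _ _ = d , refl

  ⇝-head : ∀ {a b} → a ⇝ b → ∃ (IrrEdge G a)
  ⇝-head [ a∼b ]    = _ , a∼b
  ⇝-head (a∼c ∷ _) = _ , a∼c

  stronglyConnected⇒2≤degree : Connected G → 0 < m → IrrStronglyConnected G → ∀ v → 2 ≤ degree G v
  stronglyConnected⇒2≤degree conn 0<m sc v with out-dart conn 0<m v
  ... | d , od with ⇝-head (IrrPath⇒⇝ (sc (opp d) d))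
  ...   | y , ter≡org , y≢d = two-out⇒2≤degree od (trans (sym ter≡org) (trans (opp-ter d) od))
                                  (λ d≡y → y≢d (trans (sym d≡y) (sym (opp-invol d))))

  turning⇒stronglyConnected : Connected G → (∀ a → a ⇝ opp a) → IrrStronglyConnected G
  turning⇒stronglyConnected conn turn a b =
    ⇝⇒IrrPath (connected-induction conn Reached (λ e reached → continue (reached e refl ++_))
                                   (continue id) (org b) b refl)
    where
    Reached : Fin n → Set
    Reached y = ∀ d → org d ≡ y → a ⇝ d
    continue : ∀ {x} → (∀ {y} → x ⇝ y → a ⇝ y) → Reached (ter x)
    continue {x} from-x d od with d ≟ opp x
    ... | yes refl = from-x (turn x)
    ... | no d≢opp = from-x [ sym od , d≢opp ]

  kept⁺ : ∀ {e d} → d ≢ e → d ≢ opp e → T (keptWithout G e d)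
  kept⁺ {e} {d} d≢e d≢opp with d ≟ e | d ≟ opp e
  ... | yes d≡e | _         = d≢e d≡e
  ... | no _    | yes d≡opp = d≢opp d≡opp
  ... | no _    | no _      = tt

  kept⁻ : ∀ {e d} → T (keptWithout G e d) → d ≢ e × d ≢ opp e
  kept⁻ {e} {d} d-kept with d ≟ e | d ≟ opp e
  ... | no d≢e | no d≢opp = d≢e , d≢opp

  removed : ∀ {e d} → ¬ T (keptWithout G e d) → d ≡ e ⊎ d ≡ opp e
  removed {e} {d} d-removed with d ≟ e | d ≟ opp e
  ... | yes d≡e | _         = inj₁ d≡e
  ... | no _    | yes d≡opp = inj₂ d≡opp
  ... | no _    | no _      = ⊥-elim (d-removed tt)

  kept-opp : ∀ {e d} → T (keptWithout G e d) → T (keptWithout G e (opp d))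
  kept-opp {e} {d} d-kept with kept⁻ d-kept
  ... | d≢e , d≢opp = kept⁺ (λ opp≡e → d≢opp (trans (sym (opp-invol d)) (cong opp opp≡e)))
                            (d≢e ∘ opp-injective)

  isRepresentative : Fin m → Bool
  isRepresentative d = does (toℕ d ≤? toℕ (opp d))

  representative-or-opp : ∀ d → T (isRepresentative d) ⊎ T (isRepresentative (opp d))
  representative-or-opp d with ≤-total (toℕ d) (toℕ (opp d))
  ... | inj₁ d≤opp = inj₁ (does-complete (_ ≤? _) d≤opp)
  ... | inj₂ opp≤d =
    inj₂ (does-complete (_ ≤? _) (subst (λ x → toℕ (opp d) ≤ toℕ x) (sym (opp-invol d)) opp≤d))

  both-representatives⇒half-loop : ∀ {d} → T (isRepresentative d) → T (isRepresentative (opp d)) → opp d ≡ d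
  both-representatives⇒half-loop {d} d-rep opp-rep = Fin.toℕ-injective (≤-antisym
    (subst (λ x → toℕ (opp d) ≤ toℕ x) (opp-invol d) (does-sound (_ ≤? _) opp-rep))
    (does-sound (_ ≤? _) d-rep))

  half-loop⇒representative : ∀ {d} → opp d ≡ d → T (isRepresentative d)
  half-loop⇒representative opp≡d = does-complete (_ ≤? _) (≤-reflexive (cong toℕ (sym opp≡d)))

  representatives≤cover : ∀ {j} (f : Fin j → Fin m) → (∀ d → ∃ λ t → d ≡ f t ⊎ d ≡ opp (f t)) →
    count isRepresentative ≤ j
  representatives≤cover {j} f cover = begin
    count isRepresentative ≤⟨ count-injection isRepresentative (λ _ → true) (proj₁ ∘ cover) (λ _ _ → tt) same-index ⟩
    count {j} (λ _ → true) ≡⟨ count-all j ⟩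
    j ∎
    where
    open ≤-Reasoning
    same-edge : ∀ {x y t} → T (isRepresentative x) → T (isRepresentative y) →
      x ≡ f t ⊎ x ≡ opp (f t) → y ≡ f t ⊎ y ≡ opp (f t) → x ≡ y
    same-edge _ _ (inj₁ refl) (inj₁ refl) = refl
    same-edge _ _ (inj₂ refl) (inj₂ refl) = refl
    same-edge x-rep y-rep (inj₁ refl) (inj₂ refl) = sym (both-representatives⇒half-loop x-rep y-rep)
    same-edge x-rep y-rep (inj₂ refl) (inj₁ refl) = both-representatives⇒half-loop y-rep x-rep
    same-index : ∀ x y → T (isRepresentative x) → T (isRepresentative y) →
      proj₁ (cover x) ≡ proj₁ (cover y) → x ≡ y
    same-index x y x-rep y-rep eq with cover x | cover y | eq
    ... | t , x∈ | .t , y∈ | refl = same-edge x-rep y-rep x∈ y∈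

  undirectedEdgesIn≡count : ∀ ok S →
    undirectedEdgesIn G ok S ≡ count (λ d → ok d ∧ lookup S (org d) ∧ isRepresentative d)
  undirectedEdgesIn≡count ok S = length-filterᵇ-allFin (λ d → ok d ∧ lookup S (org d) ∧ isRepresentative d)

  kept-representatives< : ∀ e → count (λ d → keptWithout G e d ∧ isRepresentative d) < count isRepresentative
  kept-representatives< e = ≰⇒> lost
    where
    Counted : Fin m → Bool
    Counted d = keptWithout G e d ∧ isRepresentative d
    still-kept : count isRepresentative ≤ count Counted → ∀ d → T (isRepresentative d) → T (keptWithout G e d)
    still-kept all≤ d rep = proj₁ (to (T-∧ {keptWithout G e d})
      (count-⊆-reverse Counted isRepresentative (λ d → proj₂ ∘ to (T-∧ {keptWithout G e d})) all≤ d rep))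
    lost : ¬ count isRepresentative ≤ count Counted
    lost all≤ with representative-or-opp e
    ... | inj₁ rep = proj₁ (kept⁻ {e} (still-kept all≤ e rep)) refl
    ... | inj₂ rep = proj₂ (kept⁻ {e} (still-kept all≤ (opp e) rep)) refl

  oneLoopy⇒2≤degree : OneLoopy G → 0 < m → ∀ v → 2 ≤ degree G v
  oneLoopy⇒2≤degree (conn , loopy) 0<m v with 2 ≤? degree G v
  ... | yes 2≤deg = 2≤deg
  ... | no 2≰deg with out-dart conn 0<m v
  ...   | d , org≡v = ⊥-elim (<⇒≱ (s≤s z≤n) (begin
      1                                   ≡⟨ ∣⁅x⁆∣≡1 v ⟨
      ∣ ⁅ v ⁆ ∣                           ≤⟨ loopy d ⁅ v ⁆ isolated ⟩
      undirectedEdgesIn G ok ⁅ v ⁆        ≡⟨ undirectedEdgesIn≡count ok ⁅ v ⁆ ⟩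
      count (λ d′ → ok d′ ∧ lookup ⁅ v ⁆ (org d′) ∧ isRepresentative d′) ≡⟨ count-none _ no-edge ⟩
      0 ∎))
    where
    open ≤-Reasoning
    ok : Fin m → Bool
    ok = keptWithout G d
    in-⁅v⁆ : ∀ {x} → lookup ⁅ v ⁆ x ≡ true → x ≡ v
    in-⁅v⁆ {x} eq = x∈⁅y⁆⇒x≡y v (lookup⇒[]= x ⁅ v ⁆ eq)
    only-d : ∀ {d′} → org d′ ≡ v → d′ ≡ d
    only-d {d′} org≡v′ with d′ ≟ d
    ... | yes d′≡d = d′≡d
    ... | no d′≢d  = ⊥-elim (2≰deg (two-out⇒2≤degree org≡v′ org≡v d′≢d))
    no-kept-out : ∀ {d′} → T (ok d′) → org d′ ≢ v
    no-kept-out d′-kept org≡v′ = proj₁ (kept⁻ {d} d′-kept) (only-d org≡v′)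
    isolated : IsComponent G ok ⁅ v ⁆
    isolated = (v , []=⇒lookup (x∈⁅x⁆ v)) ,
               (λ d′ d′-kept in-v → ⊥-elim (no-kept-out d′-kept (in-⁅v⁆ in-v))) ,
               λ x y x∈ y∈ → subst (Walk G ok x) (trans (in-⁅v⁆ x∈) (sym (in-⁅v⁆ y∈))) here
    no-edge : ∀ d′ → ¬ T (ok d′ ∧ lookup ⁅ v ⁆ (org d′) ∧ isRepresentative d′)
    no-edge d′ counted with to (T-∧ {ok d′}) counted
    ... | d′-kept , rest = no-kept-out d′-kept (in-⁅v⁆ (to T-≡ (proj₁ (to (T-∧ {lookup ⁅ v ⁆ _}) rest))))

module MinDegreeTwo (G : Graph) (2≤degree : ∀ v → 2 ≤ degree G v) where
  open Graph G
  open Darts G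

  abstract
    next : Fin m → Fin m
    next x = proj₁ (another-out (2≤degree (ter x)) (opp x))

    next-irr : ∀ x → IrrEdge G x (next x)
    next-irr x with another-out (2≤degree (ter x)) (opp x)
    ... | _ , org≡ter , ≢opp = sym org≡ter , ≢opp

  next-org : ∀ x → org (next x) ≡ ter x
  next-org x = sym (proj₁ (next-irr x))

  next^ : ℕ → Fin m → Fin m
  next^ i x = fold x next i

  module NoTurn (conn : Connected G) (a : Fin m) (¬turn : ¬ a ⇝ opp a) where

    ¬both : ∀ {d} → a ⇝ d → a ⇝ opp d → ⊥
    ¬both {d} a⇝d a⇝opp = ¬turn (a⇝d ++ subst (_⇝ opp a) (opp-invol d) (⇝-reverse a⇝opp))

    entering-unique : ∀ {x y} → a ⇝ x → a ⇝ y → ter x ≡ ter y → x ≡ y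
    entering-unique {x} {y} a⇝x a⇝y ter≡ter with x ≟ y
    ... | yes x≡y = x≡y
    ... | no x≢y  = ⊥-elim (¬both a⇝y (a⇝x ∷ʳ (trans ter≡ter (sym (opp-org y)) , x≢y ∘ sym ∘ opp-injective)))

    ⇝-next : ∀ {x} → a ⇝ x → a ⇝ next x
    ⇝-next a⇝x = a⇝x ∷ʳ next-irr _

    next-injective : ∀ {x y} → a ⇝ x → a ⇝ y → next x ≡ next y → x ≡ y
    next-injective a⇝x a⇝y eq =
      entering-unique a⇝x a⇝y (trans (sym (next-org _)) (trans (cong org eq) (next-org _)))

    next-onto : ∀ {d} → a ⇝ d → ∃ λ x → a ⇝ x × next x ≡ d
    next-onto {d} a⇝d = does-sound (hit? d) (proj₂ (to T-∧ (onto d (does-complete (a ⇝? d) a⇝d))))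
      where
      Reached : Fin m → Bool
      Reached x = does (a ⇝? x)
      reached : ∀ {x} → T (Reached x) → a ⇝ x
      reached {x} = does-sound (a ⇝? x)
      hit? : ∀ y → Dec (∃ λ x → a ⇝ x × next x ≡ y)
      hit? y = any? (λ x → (a ⇝? x) ×-dec (next x ≟ y))
      Hit : Fin m → Bool
      Hit y = Reached y ∧ does (hit? y)
      next-hits : ∀ x → T (Reached x) → T (Hit (next x))
      next-hits x a⇝x = from T-∧ (does-complete (a ⇝? next x) (⇝-next (reached a⇝x)) ,
                                  does-complete (hit? (next x)) (x , reached a⇝x , refl))
      onto : ∀ y → T (Reached y) → T (Hit y)
      onto = count-⊆-reverse Hit Reached (λ _ → proj₁ ∘ to T-∧)
        (count-injection Reached Hit next next-hits (λ x y a⇝x a⇝y → next-injective (reached a⇝x) (reached a⇝y)))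

    leaving-unique : ∀ {x y} → a ⇝ x → a ⇝ y → org x ≡ org y → x ≡ y
    leaving-unique a⇝x a⇝y org≡org with next-onto a⇝x | next-onto a⇝y
    ... | x′ , a⇝x′ , refl | y′ , a⇝y′ , refl =
      cong next (entering-unique a⇝x′ a⇝y′ (trans (sym (next-org x′)) (trans org≡org (next-org y′))))

    entered : ∀ w → ∃ λ x → a ⇝ x × ter x ≡ w
    entered = connected-induction conn (λ w → ∃ λ x → a ⇝ x × ter x ≡ w) step-entered
                                  (next a , [ next-irr a ] , refl)
      where
      step-entered : ∀ d → (∃ λ x → a ⇝ x × ter x ≡ org d) → ∃ λ x → a ⇝ x × ter x ≡ ter d
      step-entered d (x , a⇝x , ter≡org) with d ≟ opp x
      ... | no d≢opp = d , a⇝x ∷ʳ (ter≡org , d≢opp) , refl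
      ... | yes refl with next-onto a⇝x
      ...   | y , a⇝y , refl = y , a⇝y , trans (sym (next-org y)) (sym (opp-ter (next y)))

    reached-or-opposite : ∀ d → a ⇝ d ⊎ a ⇝ opp d
    reached-or-opposite d with entered (org d)
    ... | x , a⇝x , ter≡org with d ≟ opp x
    ...   | yes refl = inj₂ (subst (a ⇝_) (sym (opp-invol x)) a⇝x)
    ...   | no d≢opp = inj₁ (a⇝x ∷ʳ (ter≡org , d≢opp))

    orbit : ℕ → Fin m
    orbit i = next^ i (next a)

    ⇝-next^ : ∀ i {x} → a ⇝ x → a ⇝ next^ i x
    ⇝-next^ zero    a⇝x = a⇝x
    ⇝-next^ (suc i) a⇝x = ⇝-next (⇝-next^ i a⇝x)

    ⇝-orbit : ∀ i → a ⇝ orbit i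
    ⇝-orbit i = ⇝-next^ i [ next-irr a ]

    next^-injective : ∀ i {x y} → a ⇝ x → a ⇝ y → next^ i x ≡ next^ i y → x ≡ y
    next^-injective zero    a⇝x a⇝y eq = eq
    next^-injective (suc i) a⇝x a⇝y eq =
      next^-injective i a⇝x a⇝y (next-injective (⇝-next^ i a⇝x) (⇝-next^ i a⇝y) eq)

    orbit-shift : ∀ i p → orbit (i + p) ≡ next^ i (orbit p)
    orbit-shift i p = fold-+ (next a) next i

    orbit-period : ∀ i p → orbit i ≡ orbit (i + suc p) → orbit (suc p) ≡ orbit 0
    orbit-period i p eq = sym (next^-injective i (⇝-orbit 0) (⇝-orbit (suc p)) (trans eq (orbit-shift i (suc p))))

    Period : ℕ → Set
    Period p = orbit (suc p) ≡ orbit 0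

    some-period : ∃ Period
    some-period with pigeonhole (n<1+n m) (orbit ∘ toℕ)
    ... | i , j , i<j , eq with m≤n⇒∃[o]m+o≡n i<j
    ...   | p , 1+i+p≡j = p , orbit-period (toℕ i) p
              (trans eq (cong orbit (sym (trans (+-suc (toℕ i) p) 1+i+p≡j))))

    abstract
      minimal-period : ∃ λ p → Period p × (∀ j → j < p → ¬ Period j)
      minimal-period =
        least-witness {Period} (λ p → orbit (suc p) ≟ orbit 0) {proj₁ some-period} (proj₂ some-period)

    len : ℕ
    len = suc (proj₁ minimal-period)

    orbit-len : orbit len ≡ orbit 0
    orbit-len = proj₁ (proj₂ minimal-period)

    orbit-distinct : ∀ {i j} → i < j → j < len → orbit i ≢ orbit j
    orbit-distinct {i} i<j j<len eq with m≤n⇒∃[o]m+o≡n i<j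
    ... | p , refl = proj₂ (proj₂ minimal-period) p p<q
                       (orbit-period i p (trans eq (cong orbit (sym (+-suc i p)))))
      where
      p<q : p < proj₁ minimal-period
      p<q = ≤-trans (s≤s (m≤n+m p i)) (≤-pred j<len)

    orbit-injective : ∀ {i j} → i < len → j < len → orbit i ≡ orbit j → i ≡ j
    orbit-injective {i} {j} i<len j<len eq with <-cmp i j
    ... | tri< i<j _ _ = ⊥-elim (orbit-distinct i<j j<len eq)
    ... | tri≈ _ i≡j _ = i≡j
    ... | tri> _ _ j<i = ⊥-elim (orbit-distinct j<i i<len (sym eq))

    orbit-next : ∀ {i} → i < len → ∃ λ j → j < len × next (orbit i) ≡ orbit j
    orbit-next {i} i<len with m≤n⇒m<n∨m≡n i<len
    ... | inj₁ 1+i<len = suc i , 1+i<len , refl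
    ... | inj₂ 1+i≡len = 0 , s≤s z≤n , trans (cong orbit 1+i≡len) orbit-len

    orbit-prev : ∀ {i} → i < len → ∃ λ j → j < len × ter (orbit j) ≡ org (orbit i)
    orbit-prev {zero}  _       = proj₁ minimal-period , ≤-refl , trans (sym (next-org _)) (cong org orbit-len)
    orbit-prev {suc i} 1+i<len = i , <-trans (n<1+n i) 1+i<len , sym (next-org (orbit i))

    leaving-orbit : ∀ {i d} → i < len → org (orbit i) ≡ org d →
      d ≡ orbit i ⊎ ∃ λ j → j < len × opp d ≡ orbit j
    leaving-orbit {i} {d} i<len org≡org with reached-or-opposite d
    ... | inj₁ a⇝d   = inj₁ (leaving-unique a⇝d (⇝-orbit i) (sym org≡org))
    ... | inj₂ a⇝opp with orbit-prev i<len
    ...   | j , j<len , ter≡org =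
      inj₂ (j , j<len , entering-unique a⇝opp (⇝-orbit j) (trans (opp-ter d) (trans (sym org≡org) (sym ter≡org))))

    OnOrbit : Fin n → Set
    OnOrbit x = ∃ λ i → i < len × org (orbit i) ≡ x

    on-orbit : ∀ x → OnOrbit x
    on-orbit = connected-induction conn OnOrbit step-on-orbit (0 , s≤s z≤n , refl)
      where
      step-on-orbit : ∀ d → OnOrbit (org d) → OnOrbit (ter d)
      step-on-orbit d (i , i<len , org≡org) with leaving-orbit i<len org≡org
      ... | inj₁ refl with orbit-next i<len
      ...   | j , j<len , next≡ = j , j<len , trans (cong org (sym next≡)) (next-org d)
      step-on-orbit d _ | inj₂ (j , j<len , opp≡) = j , j<len , trans (cong org (sym opp≡)) (opp-org d)

    dart-on-orbit : ∀ d → ∃ λ i → i < len × (d ≡ orbit i ⊎ d ≡ opp (orbit i))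
    dart-on-orbit d with on-orbit (org d)
    ... | i , i<len , org≡org with leaving-orbit i<len org≡org
    ...   | inj₁ d≡orbit            = i , i<len , inj₁ d≡orbit
    ...   | inj₂ (j , j<len , opp≡) = j , j<len , inj₂ (trans (sym (opp-invol d)) (cong opp opp≡))

    isCycle : IsCycle G
    isCycle = conn , len , (λ i → org (orbit i)) , orbit , s≤s z≤n , cong org orbit-len ,
      (λ i j i<len j<len eq → orbit-injective i<len j<len (leaving-unique (⇝-orbit i) (⇝-orbit j) eq)) ,
      on-orbit ,
      (λ i _ → refl , sym (next-org (orbit i))) ,
      (λ i j i<len j<len i≢j → i≢j ∘ orbit-injective i<len j<len ,
                               λ eq → ¬both (⇝-orbit j) (subst (a ⇝_) eq (⇝-orbit i))) ,
      dart-on-orbit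

  turn : Connected G → ¬ IsCycle G → ∀ a → a ⇝ opp a
  turn conn ¬cycle a with a ⇝? opp a
  ... | yes a⇝opp = a⇝opp
  ... | no ¬turn  = ⊥-elim (¬cycle (NoTurn.isCycle conn a ¬turn))

  stronglyConnected : Connected G → ¬ IsCycle G → IrrStronglyConnected G
  stronglyConnected conn ¬cycle = turning⇒stronglyConnected conn (turn conn ¬cycle)

  module MaxDegreeTwo (degree≤2 : ∀ v → degree G v ≤ 2) (no-half-loop : ∀ d → opp d ≢ d) where

    next-unique : ∀ {x y} → IrrEdge G x y → y ≡ next x
    next-unique {x} (ter≡org , y≢opp)
      with out-pair (degree≤2 (ter x)) (opp-org x) (next-org x) (proj₂ (next-irr x) ∘ sym) (sym ter≡org)
    ... | inj₁ y≡opp  = ⊥-elim (y≢opp y≡opp)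
    ... | inj₂ y≡next = y≡next

    next-reverse : ∀ x → next (opp (next x)) ≡ opp x
    next-reverse x = sym (next-unique (IrrEdge-reverse (next-irr x)))

    next-injective : ∀ {x y} → next x ≡ next y → x ≡ y
    next-injective {x} {y} eq = opp-injective (begin
      opp x                ≡⟨ next-reverse x ⟨
      next (opp (next x)) ≡⟨ cong (next ∘ opp) eq ⟩
      next (opp (next y)) ≡⟨ next-reverse y ⟩
      opp y ∎)
      where open ≡-Reasoning

    next^-injective : ∀ i {x y} → next^ i x ≡ next^ i y → x ≡ y
    next^-injective zero    eq = eq
    next^-injective (suc i) eq = next^-injective i (next-injective eq)

    next^-suc : ∀ i x → next^ (suc i) x ≡ next^ i (next x)
    next^-suc i x = trans (cong (fold x next) (+-comm 1 i)) (fold-+ x next i)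

    next^-reverse : ∀ i x → next^ i (opp (next^ i x)) ≡ opp x
    next^-reverse zero    x = refl
    next^-reverse (suc i) x = begin
      next^ (suc i) (opp (next (next^ i x)))  ≡⟨ next^-suc i _ ⟩
      next^ i (next (opp (next (next^ i x)))) ≡⟨ cong (next^ i) (next-reverse (next^ i x)) ⟩
      next^ i (opp (next^ i x))                ≡⟨ next^-reverse i x ⟩
      opp x ∎
      where open ≡-Reasoning

    ⇝⇒next^ : ∀ {x y} → x ⇝ y → ∃ λ j → y ≡ next^ (suc j) x
    ⇝⇒next^ [ x∼y ] = 0 , next-unique x∼y
    ⇝⇒next^ {x} (x∼z ∷ z⇝y) with ⇝⇒next^ z⇝y
    ... | j , refl = suc j , trans (cong (next^ (suc j)) (next-unique x∼z)) (sym (next^-suc (suc j) x))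

    ¬turn : ∀ a → ¬ a ⇝ opp a
    ¬turn a a⇝opp with ⇝⇒next^ a⇝opp
    ... | j , opp≡ with even-or-odd (suc j)
    ...   | i , inj₁ 1+j≡i+i = no-half-loop (next^ i a) (next^-injective i (begin
      next^ i (opp (next^ i a))  ≡⟨ next^-reverse i a ⟩
      opp a                       ≡⟨ opp≡ ⟩
      next^ (suc j) a             ≡⟨ cong (fold a next) 1+j≡i+i ⟩
      next^ (i + i) a             ≡⟨ fold-+ a next i ⟩
      next^ i (next^ i a) ∎))
      where open ≡-Reasoning
    ...   | i , inj₂ 1+j≡1+i+i = proj₂ (next-irr (next^ i a))
      (trans (sym (opp-invol _)) (cong opp (next^-injective (suc i) (begin
        next^ (suc i) (opp (next^ (suc i) a)) ≡⟨ next^-reverse (suc i) a ⟩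
        opp a                                   ≡⟨ opp≡ ⟩
        next^ (suc j) a                         ≡⟨ cong (fold a next) 1+j≡1+i+i ⟩
        next^ (suc i + i) a                     ≡⟨ fold-+ a next (suc i) ⟩
        next^ (suc i) (next^ i a) ∎))))
      where open ≡-Reasoning

module Cycle (G : Graph) where
  open Graph G
  open Darts G

  module Listing (k : ℕ) (v : ℕ → Fin n) (ed : ℕ → Fin m)
    (v-closes : v (suc k) ≡ v 0)
    (v-injective : ∀ i j → i < suc k → j < suc k → v i ≡ v j → i ≡ j)
    (v-covers : ∀ x → ∃ λ i → i < suc k × v i ≡ x)
    (ed-joins : ∀ i → i < suc k → org (ed i) ≡ v i × ter (ed i) ≡ v (suc i))
    (ed-distinct : ∀ i j → i < suc k → j < suc k → i ≢ j → ed i ≢ ed j × ed i ≢ opp (ed j))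
    (ed-covers : ∀ d → ∃ λ i → i < suc k × (d ≡ ed i ⊎ d ≡ opp (ed i)))
    where

    v-suc-injective : ∀ {i j} → i < suc k → j < suc k → v (suc i) ≡ v (suc j) → i ≡ j
    v-suc-injective {i} {j} i<K j<K eq with m≤n⇒m<n∨m≡n i<K | m≤n⇒m<n∨m≡n j<K
    ... | inj₁ 1+i<K | inj₁ 1+j<K = suc-injective (v-injective _ _ 1+i<K 1+j<K eq)
    ... | inj₂ 1+i≡K | inj₂ 1+j≡K = suc-injective (trans 1+i≡K (sym 1+j≡K))
    ... | inj₂ 1+i≡K | inj₁ 1+j<K with () ← v-injective 0 (suc j) (s≤s z≤n) 1+j<K
                                              (trans (sym v-closes) (trans (cong v (sym 1+i≡K)) eq))
    ... | inj₁ 1+i<K | inj₂ 1+j≡K with () ← v-injective 0 (suc i) (s≤s z≤n) 1+i<K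
                                              (trans (sym v-closes) (trans (cong v (sym 1+j≡K)) (sym eq)))

    OnCycle : Fin m → Set
    OnCycle d = ∃ λ j → j < suc k × d ≡ ed j

    irr-step : ∀ {i d} → i < suc k → IrrEdge G (ed i) d → OnCycle d
    irr-step {i} {d} i<K (ter≡org , d≢opp) with ed-covers d
    ... | j , j<K , inj₁ d≡ed = j , j<K , d≡ed
    ... | j , j<K , inj₂ d≡opp with v-suc-injective i<K j<K (begin
      v (suc i)       ≡⟨ proj₂ (ed-joins i i<K) ⟨
      ter (ed i)      ≡⟨ ter≡org ⟩
      org d           ≡⟨ cong org d≡opp ⟩
      org (opp (ed j)) ≡⟨ opp-org (ed j) ⟩
      ter (ed j)      ≡⟨ proj₂ (ed-joins j j<K) ⟩
      v (suc j) ∎)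
      where open ≡-Reasoning
    ... | refl = ⊥-elim (d≢opp d≡opp)

    ⇝-stays : ∀ {d d′} → d ⇝ d′ → OnCycle d → OnCycle d′
    ⇝-stays [ d∼d′ ]        (i , i<K , refl) = irr-step i<K d∼d′
    ⇝-stays (d∼d″ ∷ d″⇝d′) (i , i<K , refl) = ⇝-stays d″⇝d′ (irr-step i<K d∼d″)

    half-loop⇒v₀≡v₁ : opp (ed 0) ≡ ed 0 → v 0 ≡ v 1
    half-loop⇒v₀≡v₁ opp≡ed = begin
      v 0              ≡⟨ proj₁ (ed-joins 0 (s≤s z≤n)) ⟨
      org (ed 0)       ≡⟨ cong org opp≡ed ⟨
      org (opp (ed 0)) ≡⟨ opp-org (ed 0) ⟩
      ter (ed 0)       ≡⟨ proj₂ (ed-joins 0 (s≤s z≤n)) ⟩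
      v 1 ∎
      where open ≡-Reasoning

    ¬stronglyConnected : ¬ IrrStronglyConnected G
    ¬stronglyConnected sc with ⇝-stays (IrrPath⇒⇝ (sc (ed 0) (opp (ed 0)))) (0 , s≤s z≤n , refl)
    ... | suc j , 1+j<K , opp≡ed = proj₂ (ed-distinct (suc j) 0 1+j<K (s≤s z≤n) (λ ())) (sym opp≡ed)
    ... | zero  , _     , opp≡ed with m≤n⇒m<n∨m≡n (s≤s (z≤n {k}))
    ...   | inj₁ 1<K with () ← v-injective 0 1 (s≤s z≤n) 1<K (half-loop⇒v₀≡v₁ opp≡ed)
    ...   | inj₂ 1≡K with ⇝-head (IrrPath⇒⇝ (sc (ed 0) (ed 0)))
    ...     | y , y-irr with irr-step (s≤s z≤n) y-irr
    ...       | j , j<K , refl with n<1⇒n≡0 (subst (j <_) (sym 1≡K) j<K)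
    ...         | refl = proj₂ y-irr (sym opp≡ed)

    degree≤2 : degree G (v 0) ≤ 2
    degree≤2 = degree≤cover (ed 0 ∷ opp (ed k) ∷ []) out-of-v₀
      where
      out-of-v₀ : ∀ d → org d ≡ v 0 → d ∈ ed 0 ∷ opp (ed k) ∷ []
      out-of-v₀ d org≡v₀ with ed-covers d
      ... | j , j<K , inj₁ refl with v-injective j 0 j<K (s≤s z≤n) (trans (sym (proj₁ (ed-joins j j<K))) org≡v₀)
      ...   | refl = here refl
      out-of-v₀ d org≡v₀ | j , j<K , inj₂ refl with m≤n⇒m<n∨m≡n j<K
      ... | inj₂ 1+j≡K = there (here (cong (opp ∘ ed) (suc-injective 1+j≡K)))
      ... | inj₁ 1+j<K with () ← v-injective (suc j) 0 1+j<K (s≤s z≤n)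
                                   (trans (sym (proj₂ (ed-joins j j<K))) (trans (sym (opp-org (ed j))) org≡v₀))

    private
      ok : Fin m → Bool
      ok = keptWithout G (ed 0)

      ed-kept : ∀ {i} → 0 < i → i < suc k → T (ok (ed i))
      ed-kept {i} 0<i i<K with ed-distinct i 0 i<K (s≤s z≤n) (λ { refl → <-irrefl refl 0<i })
      ... | ed≢ed₀ , ed≢opp = kept⁺ ed≢ed₀ ed≢opp

      ascend : ∀ r {i} → 0 < i → i + r ≡ suc k → Walk G ok (v i) (v (suc k))
      ascend zero    {i} _   i+0≡K = subst (λ j → Walk G ok (v i) (v j)) (trans (sym (+-identityʳ i)) i+0≡K) here
      ascend (suc r) {i} 0<i i+r≡K =
        stepʷ (ed i) (ed-kept 0<i i<K) (proj₁ (ed-joins i i<K)) (proj₂ (ed-joins i i<K))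
              (ascend r (s≤s z≤n) (trans (sym (+-suc i r)) i+r≡K))
        where
        i<K : i < suc k
        i<K = subst (i <_) i+r≡K (m<m+n i (s≤s z≤n))

      to-v₀ : ∀ {i} → i < suc k → Walk G ok (v i) (v 0)
      to-v₀ {zero}  _       = here
      to-v₀ {suc i} 1+i<K = subst (Walk G ok (v (suc i))) v-closes
        (ascend (suc k ∸ suc i) (s≤s z≤n) (m+[n∸m]≡n (<⇒≤ 1+i<K)))

      whole-component : IsComponent G ok ⊤
      whole-component = (v 0 , lookup-replicate (v 0) true) , (λ d _ _ → lookup-replicate (ter d) true) , walk
        where
        walk : ∀ x y → _ → _ → Walk G ok x y
        walk x y _ _ with v-covers x | v-covers y
        ... | i , i<K , refl | j , j<K , refl = to-v₀ i<K ++ʷ reverseʷ kept-opp (to-v₀ j<K)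

      length≤∣⊤∣ : suc k ≤ ∣ ⊤ {n} ∣
      length≤∣⊤∣ = subst (suc k ≤_) (sym (∣⊤∣≡n n)) (injective⇒≤ v-injective′)
        where
        v-injective′ : ∀ {s t : Fin (suc k)} → v (toℕ s) ≡ v (toℕ t) → s ≡ t
        v-injective′ {s} {t} eq = Fin.toℕ-injective (v-injective (toℕ s) (toℕ t) (Fin.toℕ<n s) (Fin.toℕ<n t) eq)

      edges<length : undirectedEdgesIn G ok ⊤ < suc k
      edges<length = begin-strict
        undirectedEdgesIn G ok ⊤                 ≡⟨ undirectedEdgesIn≡count ok ⊤ ⟩
        count (λ d → ok d ∧ lookup ⊤ (org d) ∧ isRepresentative d)
                                                 ≡⟨ count-cong (λ d → cong (λ b → ok d ∧ b ∧ isRepresentative d) (in-⊤ (org d))) ⟩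
        count (λ d → ok d ∧ isRepresentative d) <⟨ kept-representatives< (ed 0) ⟩
        count isRepresentative                   ≤⟨ representatives≤cover (ed ∘ toℕ) cover ⟩
        suc k ∎
        where
        open ≤-Reasoning
        in-⊤ : ∀ x → lookup ⊤ x ≡ true
        in-⊤ x = lookup-replicate x true
        cover : ∀ d → ∃ λ (t : Fin (suc k)) → d ≡ ed (toℕ t) ⊎ d ≡ opp (ed (toℕ t))
        cover d with ed-covers d
        ... | i , i<K , d∈ = fromℕ< i<K , subst (λ j → d ≡ ed j ⊎ d ≡ opp (ed j)) (sym (Fin.toℕ-fromℕ< i<K)) d∈

    ¬oneLoopy : ¬ OneLoopy G
    ¬oneLoopy (_ , loopy) = <⇒≱ edges<length (≤-trans length≤∣⊤∣ (loopy (ed 0) ⊤ whole-component))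

  cycle⇒¬stronglyConnected : IsCycle G → ¬ IrrStronglyConnected G
  cycle⇒¬stronglyConnected (_ , suc k , v , ed , _ , closes , v-inj , v-cov , joins , distinct , ed-cov) =
    Listing.¬stronglyConnected k v ed closes v-inj v-cov joins distinct ed-cov

  cycle⇒¬oneLoopy : IsCycle G → ¬ OneLoopy G
  cycle⇒¬oneLoopy (_ , suc k , v , ed , _ , closes , v-inj , v-cov , joins , distinct , ed-cov) =
    Listing.¬oneLoopy k v ed closes v-inj v-cov joins distinct ed-cov

  cycle⇒degree≤2 : IsCycle G → ∃ λ v → degree G v ≤ 2
  cycle⇒degree≤2 (_ , suc k , v , ed , _ , closes , v-inj , v-cov , joins , distinct , ed-cov) =
    v 0 , Listing.degree≤2 k v ed closes v-inj v-cov joins distinct ed-cov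

module Component (G : Graph) (e : Fin (Graph.m G)) (S : Subset (Graph.n G))
  (component : IsComponent G (keptWithout G e) S) where
  open Graph G
  open Darts G

  ok : Fin m → Bool
  ok = keptWithout G e

  In : Fin n → Bool
  In = lookup S

  From : Fin m → Bool
  From d = In (org d)

  fibre : Fin n → ℕ
  fibre y = count (λ d → From d ∧ does (org d ≟ y))

  fibre≡ : ∀ y → fibre y ≡ (if In y then degree G y else 0)
  fibre≡ y = trans (count-cong at-y) (by-cases (In y))
    where
    at-y : ∀ d → From d ∧ does (org d ≟ y) ≡ In y ∧ does (org d ≟ y)
    at-y d with org d ≟ y
    ... | yes refl = refl
    ... | no _     = trans (∧-zeroʳ (From d)) (sym (∧-zeroʳ (In y)))
    by-cases : ∀ b → count (λ d → b ∧ does (org d ≟ y)) ≡ (if b then degree G y else 0)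
    by-cases true  = sym (degree≡count y)
    by-cases false = count-none {m} (λ _ → false) (λ _ ())

  twice : Fin n → ℕ
  twice y = if In y then 2 else 0

  Σfibre≡From : sum fibre ≡ count From
  Σfibre≡From = count-fibres org From

  Σtwice≡2∣S∣ : sum twice ≡ ∣ S ∣ + ∣ S ∣
  Σtwice≡2∣S∣ = begin
    sum twice                               ≡⟨ sum-cong-≗ (λ y → double (In y)) ⟩
    sum (λ y → indicator (In y) + indicator (In y)) ≡⟨ ∑-distrib-+ (indicator ∘ In) (indicator ∘ In) ⟩
    count In + count In                     ≡⟨ cong₂ _+_ (∣p∣≡count S) (∣p∣≡count S) ⟨
    ∣ S ∣ + ∣ S ∣ ∎
    where
    open ≡-Reasoning
    double : ∀ b → (if b then 2 else 0) ≡ indicator b + indicator b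
    double true  = refl
    double false = refl

  closed : ∀ {d} → T (ok d) → T (From d) → T (From (opp d))
  closed {d} d-kept from-S =
    subst (T ∘ In) (sym (opp-org d)) (from T-≡ (proj₁ (proj₂ component) d d-kept (to T-≡ from-S)))

  twice≤fibre : (∀ v → 2 ≤ degree G v) → ∀ y → twice y ≤ fibre y
  twice≤fibre 2≤degree y rewrite fibre≡ y with In y
  ... | true  = 2≤degree y
  ... | false = z≤n

  2∣S∣≤From : (∀ v → 2 ≤ degree G v) → ∣ S ∣ + ∣ S ∣ ≤ count From
  2∣S∣≤From 2≤degree = begin
    ∣ S ∣ + ∣ S ∣ ≡⟨ Σtwice≡2∣S∣ ⟨
    sum twice     ≤⟨ sum-mono (twice≤fibre 2≤degree) ⟩
    sum fibre     ≡⟨ Σfibre≡From ⟩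
    count From ∎
    where open ≤-Reasoning

  Kept : Fin m → Bool
  Kept d = From d ∧ ok d

  Removed : Fin m → Bool
  Removed d = From d ∧ not (ok d)

  From-split : count From ≡ count Kept + count Removed
  From-split = count-split From ok

  Removed≤2 : count Removed ≤ 2
  Removed≤2 = count≤cover Removed (e ∷ opp e ∷ []) λ d d-removed →
    case removed {e} {d} (T-not⇒¬T (proj₂ (to (T-∧ {From d}) d-removed))) of λ
      { (inj₁ refl) → here refl
      ; (inj₂ refl) → there (here refl) }

  Edge : Fin m → Bool
  Edge d = Kept d ∧ isRepresentative d

  HalfLoop : Fin m → Bool
  HalfLoop d = does (opp d ≟ d)

  edges≡ : undirectedEdgesIn G ok S ≡ count Edge
  edges≡ = trans (undirectedEdgesIn≡count ok S) (count-cong reorder)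
    where
    reorder : ∀ d → ok d ∧ From d ∧ isRepresentative d ≡ Edge d
    reorder d with ok d | From d
    ... | true  | true  = refl
    ... | true  | false = refl
    ... | false | true  = refl
    ... | false | false = refl

  -- every kept dart leaving S is a representative, or the opposite of one that is not a half-loop
  Kept+halfLoops≤2edges : count Kept + count (λ d → Edge d ∧ HalfLoop d) ≤ count Edge + count Edge
  Kept+halfLoops≤2edges = begin
    count Kept + H                   ≡⟨ cong (_+ H) (count-split Kept isRepresentative) ⟩
    count Edge + nonRep + H          ≤⟨ +-monoˡ-≤ H (+-monoʳ-≤ (count Edge) nonRep≤proper) ⟩
    count Edge + proper + H          ≡⟨ +-assoc (count Edge) proper H ⟩
    count Edge + (proper + H)        ≡⟨ cong (count Edge +_) (+-comm proper H) ⟩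
    count Edge + (H + proper)        ≡⟨ cong (count Edge +_) (count-split Edge HalfLoop) ⟨
    count Edge + count Edge ∎
    where
    open ≤-Reasoning
    H nonRep proper : ℕ
    H = count (λ d → Edge d ∧ HalfLoop d)
    nonRep = count (λ d → Kept d ∧ not (isRepresentative d))
    proper = count (λ d → Edge d ∧ not (HalfLoop d))
    opp-proper : ∀ d → T (Kept d ∧ not (isRepresentative d)) → T (Edge (opp d) ∧ not (HalfLoop (opp d)))
    opp-proper d h with to (T-∧ {Kept d}) h
    ... | kept-d , ¬rep with to (T-∧ {From d}) kept-d
    ...   | from-d , ok-d with representative-or-opp d
    ...     | inj₁ rep = ⊥-elim (T-not⇒¬T ¬rep rep)
    ...     | inj₂ opp-rep =
      from T-∧ (from T-∧ (from T-∧ (closed ok-d from-d , kept-opp ok-d) , opp-rep) ,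
                ¬T⇒T-not λ half → T-not⇒¬T ¬rep (half-loop⇒representative (sym (d≡opp half))))
      where
      d≡opp : T (HalfLoop (opp d)) → d ≡ opp d
      d≡opp half = trans (sym (opp-invol d)) (does-sound (opp (opp d) ≟ opp d) half)
    nonRep≤proper : nonRep ≤ proper
    nonRep≤proper = count-injection _ _ opp opp-proper (λ x y _ _ → opp-injective)

  module FewEdges (conn : Connected G) (2≤degree : ∀ v → 2 ≤ degree G v)
                  (few : undirectedEdgesIn G ok S < ∣ S ∣) where

    private
      tight : count Removed ≡ 2 × count (λ d → Edge d ∧ HalfLoop d) ≡ 0 ×
              count Kept + count Removed ≤ ∣ S ∣ + ∣ S ∣
      tight = squeeze (subst (∣ S ∣ + ∣ S ∣ ≤_) From-split (2∣S∣≤From 2≤degree))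
                      Kept+halfLoops≤2edges Removed≤2 (subst (_< ∣ S ∣) edges≡ few)

    Removed≡2 : count Removed ≡ 2
    Removed≡2 = proj₁ tight

    no-half-loop-edge : count (λ d → Edge d ∧ HalfLoop d) ≡ 0
    no-half-loop-edge = proj₁ (proj₂ tight)

    From≤2∣S∣ : count From ≤ ∣ S ∣ + ∣ S ∣
    From≤2∣S∣ = subst (_≤ ∣ S ∣ + ∣ S ∣) (sym From-split) (proj₂ (proj₂ tight))

    removed-not-single : ∀ x → ¬ (∀ d → T (Removed d) → d ≡ x)
    removed-not-single x only-x = <⇒≱ (s≤s (s≤s z≤n))
      (subst (_≤ 1) Removed≡2 (count≤cover Removed (x ∷ []) (λ d r → here (only-x d r))))

    removed-is : ∀ {d} → T (Removed d) → d ≡ e ⊎ d ≡ opp e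
    removed-is {d} r = removed {e} {d} (T-not⇒¬T (proj₂ (to (T-∧ {From d}) r)))

    e-not-half-loop : opp e ≢ e
    e-not-half-loop opp≡e = removed-not-single e λ d r → case removed-is r of λ
      { (inj₁ d≡e)   → d≡e
      ; (inj₂ d≡opp) → trans d≡opp opp≡e }

    e-from-S : T (From e)
    e-from-S with T? (From e)
    ... | yes from-e = from-e
    ... | no ¬from-e = ⊥-elim (removed-not-single (opp e) λ d r → case removed-is r of λ
      { (inj₁ refl)  → ⊥-elim (¬from-e (proj₁ (to (T-∧ {From e}) r)))
      ; (inj₂ d≡opp) → d≡opp })

    opp-e-from-S : T (From (opp e))
    opp-e-from-S with T? (From (opp e))
    ... | yes from-opp = from-opp
    ... | no ¬from-opp = ⊥-elim (removed-not-single e λ d r → case removed-is r of λ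
      { (inj₁ d≡e)  → d≡e
      ; (inj₂ refl) → ⊥-elim (¬from-opp (proj₁ (to (T-∧ {From (opp e)}) r))) })

    S-everything : ∀ x → T (In x)
    S-everything = connected-induction conn (T ∘ In) S-closed e-from-S
      where
      S-closed : ∀ d → T (From d) → T (In (ter d))
      S-closed d from-d with T? (ok d)
      ... | yes ok-d = subst (T ∘ In) (opp-org d) (closed ok-d from-d)
      ... | no ¬ok-d with removed {e} {d} ¬ok-d
      ...   | inj₁ refl = subst (T ∘ In) (opp-org e) opp-e-from-S
      ...   | inj₂ refl = subst (T ∘ In) (sym (opp-ter e)) e-from-S

    degree≤2 : ∀ v → degree G v ≤ 2
    degree≤2 v = ≤-reflexive (begin
      degree G v                          ≡⟨ degree-in-S ⟨
      (if In v then degree G v else 0)    ≡⟨ fibre≡ v ⟨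
      fibre v                             ≡⟨ sum-tight fibre twice (twice≤fibre 2≤degree)
                                               (subst₂ _≤_ (sym Σfibre≡From) (sym Σtwice≡2∣S∣) From≤2∣S∣) v ⟩
      twice v                             ≡⟨ twice-in-S ⟩
      2 ∎)
      where
      open ≡-Reasoning
      degree-in-S : (if In v then degree G v else 0) ≡ degree G v
      degree-in-S with In v | S-everything v
      ... | true | _ = refl
      twice-in-S : twice v ≡ 2
      twice-in-S with In v | S-everything v
      ... | true | _ = refl

    no-half-loop : ∀ d → opp d ≢ d
    no-half-loop d opp≡d with T? (ok d)
    ... | yes ok-d =
      <⇒≱ (count-positive (λ d → Edge d ∧ HalfLoop d) {d} half-loop-edge) (≤-reflexive no-half-loop-edge)
      where
      half-loop-edge : T (Edge d ∧ HalfLoop d)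
      half-loop-edge = from T-∧ (from T-∧ (from T-∧ (S-everything (org d) , ok-d) , half-loop⇒representative opp≡d) ,
                                 does-complete (opp d ≟ d) opp≡d)
    ... | no ¬ok-d with removed {e} {d} ¬ok-d
    ...   | inj₁ refl = e-not-half-loop opp≡d
    ...   | inj₂ refl = e-not-half-loop (trans (sym opp≡d) (opp-invol e))

stronglyConnected⇒oneLoopy : ∀ G → Connected G → 0 < Graph.m G → IrrStronglyConnected G → OneLoopy G
stronglyConnected⇒oneLoopy G conn 0<m sc = conn , loopy
  where
  open Graph G
  2≤degree : ∀ v → 2 ≤ degree G v
  2≤degree = Darts.stronglyConnected⇒2≤degree G conn 0<m sc
  loopy : ∀ e S → IsComponent G (keptWithout G e) S → LoopyComponent G (keptWithout G e) S
  loopy e S component with ∣ S ∣ ≤? undirectedEdgesIn G (keptWithout G e) S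
  ... | yes loopy-S = loopy-S
  ... | no ¬loopy-S = ⊥-elim (¬turn e (Darts.IrrPath⇒⇝ G (sc e (opp e))))
    where
    open Component.FewEdges G e S component conn 2≤degree (≰⇒> ¬loopy-S)
    open MinDegreeTwo.MaxDegreeTwo G 2≤degree degree≤2 no-half-loop

¬cycle∧minDegree2⇒stronglyConnected : ∀ G → Connected G → ¬ IsCycle G × (∀ v → 2 ≤ degree G v) →
  IrrStronglyConnected G
¬cycle∧minDegree2⇒stronglyConnected G conn (¬cycle , 2≤degree) = MinDegreeTwo.stronglyConnected G 2≤degree conn ¬cycle

stronglyConnected⇒¬cycle∧minDegree2 : ∀ G → Connected G → 0 < Graph.m G → IrrStronglyConnected G →
  ¬ IsCycle G × (∀ v → 2 ≤ degree G v)
stronglyConnected⇒¬cycle∧minDegree2 G conn 0<m sc =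
  (λ cycle → Cycle.cycle⇒¬stronglyConnected G cycle sc) , Darts.stronglyConnected⇒2≤degree G conn 0<m sc

oneLoopy⇒stronglyConnected : ∀ G → Connected G → 0 < Graph.m G → OneLoopy G → IrrStronglyConnected G
oneLoopy⇒stronglyConnected G conn 0<m oneLoopy = ¬cycle∧minDegree2⇒stronglyConnected G conn
  ((λ cycle → Cycle.cycle⇒¬oneLoopy G cycle oneLoopy) , Darts.oneLoopy⇒2≤degree G oneLoopy 0<m)

regular⇒stronglyConnected : ∀ G d → Connected G → Regular G d → 3 ≤ d → IrrStronglyConnected G
regular⇒stronglyConnected G d conn d-regular 3≤d = ¬cycle∧minDegree2⇒stronglyConnected G conn (¬cycle , 2≤degree)
  where
  2≤degree : ∀ v → 2 ≤ degree G v
  2≤degree v = subst (2 ≤_) (sym (d-regular v)) (≤-trans (n≤1+n 2) 3≤d)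
  ¬cycle : ¬ IsCycle G
  ¬cycle cycle with Cycle.cycle⇒degree≤2 G cycle
  ... | v , degree≤2 = <⇒≱ (subst (2 <_) (sym (d-regular v)) 3≤d) degree≤2

theorem3p9 : (∀ (G : Graph) → Connected G → 0 < Graph.m G →
                (OneLoopy G ⇔ IrrStronglyConnected G) ×
                (IrrStronglyConnected G ⇔ (¬ IsCycle G × (∀ v → 2 ≤ degree G v))))
           × (∀ (G : Graph) (d : ℕ) → Connected G → Regular G d → 3 ≤ d →
                IrrStronglyConnected G)
theorem3p9 =
  (λ G conn 0<m →
    mk⇔ (oneLoopy⇒stronglyConnected G conn 0<m) (stronglyConnected⇒oneLoopy G conn 0<m) ,
    mk⇔ (stronglyConnected⇒¬cycle∧minDegree2 G conn 0<m) (¬cycle∧minDegree2⇒stronglyConnected G conn)) ,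
  regular⇒stronglyConnected
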